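{- Let $\Gamma$ be a vertex-transitive graph with $\mathrm{diam}(\Gamma)\in\{1,2\}$. Then $\Gamma$ admits no extended irregular dominating set.
   Context: Let $\Gamma=(V,E)$ be an undirected simple graph with graph distance $d$ and diameter $\mathrm{diam}(\Gamma)$. A vertex $v$ carrying a positive integer label $\ell$ dominates exactly the vertices $u$ with $d(u,v)=\ell$; a vertex carrying label $0$ dominates only itself. An extended irregular dominating set is a set $S\subseteq V$ together with an injective labeling $\lambda:S\to\{0,1,2,\dots\}$ such that every vertex of $V$ is dominated by at least one vertex of $S$, where some vertex of $S$ has label $0$. -}

module Defs where

open import Data.Nat using (ℕ; zero; suc; _≤_; _<_)
open import Data.Fin using (Fin)
open import Data.Maybe using (Maybe; just; nothing)
open import Data.Product using (Σ; ∃; ∃-syntax; _×_; _,_)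
open import Data.Sum using (_⊎_)
open import Data.Empty using (⊥)
open import Relation.Nullary using (¬_)
open import Relation.Binary.PropositionalEquality using (_≡_)
open import Function.Bundles using (_⤖_; Bijection)

record Graph (n : ℕ) : Set₁ where
  field
    Adj     : Fin n → Fin n → Set
    symm    : ∀ {u v} → Adj u v → Adj v u
    irrefl  : ∀ {u} → ¬ Adj u u

module _ {n : ℕ} (Γ : Graph n) where
  open Graph Γ

  data Walk : Fin n → Fin n → ℕ → Set where
    [] : ∀ {u} → Walk u u zero
    _∷_ : ∀ {u w v k} → Adj u w → Walk w v k → Walk u v (suc k)

  Dist : Fin n → Fin n → ℕ → Set
  Dist u v k = Walk u v k × (∀ j → j < k → ¬ Walk u v j)

  Diam : ℕ → Set
  Diam d = (∀ u v → ∃[ k ] (k ≤ d × Dist u v k)) × (∃[ u ] ∃[ v ] Dist u v d)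

  IsAutomorphism : (Fin n ⤖ Fin n) → Set
  IsAutomorphism f = ∀ u v → (Adj u v → Adj (F u) (F v)) × (Adj (F u) (F v) → Adj u v)
    where open Bijection f renaming (to to F)

  VertexTransitive : Set
  VertexTransitive = ∀ u v → Σ (Fin n ⤖ Fin n) λ f →
    IsAutomorphism f × Bijection.to f u ≡ v

  Dominates : Fin n → ℕ → Fin n → Set
  Dominates v zero    u = u ≡ v
  Dominates v (suc ℓ) u = Dist u v (suc ℓ)

  -- An extended irregular dominating set: S together with an injective labeling
  -- λ : S → ℕ, encoded as a partial labeling Fin n → Maybe ℕ
  -- (λ v ≡ nothing  means v ∉ S).
  IsExtendedIrregularDominatingSet : (Fin n → Maybe ℕ) → Set
  IsExtendedIrregularDominatingSet lab =
      (∀ u v ℓ → lab u ≡ just ℓ → lab v ≡ just ℓ → u ≡ v)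
    × (∀ u → ∃[ v ] ∃[ ℓ ] (lab v ≡ just ℓ × Dominates v ℓ u))
    × (∃[ v ] lab v ≡ just zero)

  AdmitsExtendedIrregularDominatingSet : Set
  AdmitsExtendedIrregularDominatingSet =
    ∃[ lab ] IsExtendedIrregularDominatingSet lab

-- With diameter ≤ 2 only the labels 0, 1, 2 dominate anything.  No vertex can carry
-- label 1: the vertex y labelled 1 would have to be dominated from distance 2 by the
-- vertex z labelled 2, and then nothing is left to dominate z.  Hence every vertex
-- other than the one labelled 0 lies at distance 2 from z, so z has at most one
-- neighbour.  With diameter 1 this already fails for the two endpoints of an edge;
-- with diameter 2 the middle vertex of a geodesic a – c – b has two neighbours, and
-- vertex transitivity moves c onto z.
module Submission where

open import Defs
open import Data.Nat using (ℕ; zero; suc; _+_; _≤_; z≤n; s≤s)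
open import Data.Nat.Properties using (<-cmp)
open import Data.Fin using (Fin)
open import Data.Maybe using (Maybe; just)
open import Data.Maybe.Properties using (just-injective)
open import Data.Product using (∃-syntax; _×_; _,_; proj₁)
open import Data.Sum using (_⊎_; inj₁; inj₂)
open import Data.Empty using (⊥-elim)
open import Relation.Nullary using (¬_)
open import Relation.Binary using (tri<; tri≈; tri>)
open import Relation.Binary.PropositionalEquality using (_≡_; _≢_; refl; sym; trans; subst)
open import Function.Bundles using (Bijection)

module _ {n : ℕ} (Γ : Graph n) where
  open Graph Γ

  Dist-functional : ∀ {u v k m} → Dist Γ u v k → Dist Γ u v m → k ≡ m
  Dist-functional {k = k} {m} (walk-k , min-k) (walk-m , min-m) with <-cmp k m
  ... | tri< k<m _ _ = ⊥-elim (min-m k k<m walk-k)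
  ... | tri≈ _ k≡m _ = k≡m
  ... | tri> _ _ m<k = ⊥-elim (min-k m m<k walk-m)

  Walk-zero⇒≡ : ∀ {u v} → Walk Γ u v 0 → u ≡ v
  Walk-zero⇒≡ [] = refl

  Adj⇒Dist-one : ∀ {u v} → Adj u v → Dist Γ u v 1
  Adj⇒Dist-one {u} uv = (uv ∷ []) , λ { zero (s≤s z≤n) w → irrefl (subst (Adj u) (sym (Walk-zero⇒≡ w)) uv) }

  Dist-one⇒Adj : ∀ {u v} → Dist Γ u v 1 → Adj u v
  Dist-one⇒Adj ((uv ∷ []) , _) = uv

  Dist-suc⇒≢ : ∀ {u v k} → Dist Γ u v (suc k) → u ≢ v
  Dist-suc⇒≢ (_ , minimal) refl = minimal zero (s≤s z≤n) []

  Adj⇒¬Dist-two : ∀ {u v} → Adj u v → ¬ Dist Γ u v 2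
  Adj⇒¬Dist-two uv d with Dist-functional (Adj⇒Dist-one uv) d
  ... | ()

  Dist≤Diam : ∀ {d u v k} → Diam Γ d → Dist Γ u v k → k ≤ d
  Dist≤Diam {u = u} {v} (bounded , _) d-uv with bounded u v
  ... | k , k≤d , d-uv′ rewrite Dist-functional d-uv d-uv′ = k≤d

  Diam≤2⇒¬Dist≥3 : ∀ {u v k} → Diam Γ 1 ⊎ Diam Γ 2 → ¬ Dist Γ u v (3 + k)
  Diam≤2⇒¬Dist≥3 (inj₁ diam) d with Dist≤Diam diam d
  ... | s≤s ()
  Diam≤2⇒¬Dist≥3 (inj₂ diam) d with Dist≤Diam diam d
  ... | s≤s (s≤s ())

  HasTwoNeighbours : Fin n → Set
  HasTwoNeighbours z = ∃[ u ] ∃[ v ] (Adj u z × Adj v z × u ≢ v)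

  VertexTransitive⇒HasTwoNeighbours : VertexTransitive Γ →
    ∀ {c} → HasTwoNeighbours c → ∀ z → HasTwoNeighbours z
  VertexTransitive⇒HasTwoNeighbours vt {c} (a , b , ac , bc , a≢b) z with vt c z
  ... | f , aut , f-c≡z = F a , F b , move a ac , move b bc , λ e → a≢b (Bijection.injective f e)
    where
    F = Bijection.to f
    move : ∀ u → Adj u c → Adj (F u) z
    move u uc = subst (Adj (F u)) f-c≡z (proj₁ (aut u c) uc)

  module _ (diam≤2 : Diam Γ 1 ⊎ Diam Γ 2) {lab : Fin n → Maybe ℕ}
           (injective : ∀ u v ℓ → lab u ≡ just ℓ → lab v ≡ just ℓ → u ≡ v)
           (dominated : ∀ u → ∃[ v ] ∃[ ℓ ] (lab v ≡ just ℓ × Dominates Γ v ℓ u)) where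

    labels-differ : ∀ {u v a b} → lab u ≡ just a → lab v ≡ just b → a ≢ b → u ≢ v
    labels-differ lu lv a≢b refl = a≢b (just-injective (trans (sym lu) lv))

    Dist-two-from-label-two⇒¬label-one : ∀ {z} → lab z ≡ just 2 → ∀ {y} → Dist Γ y z 2 → ¬ lab y ≡ just 1
    Dist-two-from-label-two⇒¬label-one {z} lz {y} yz ly with dominated z
    ... | w , zero , lw , refl = labels-differ lz lw (λ ()) refl
    ... | w , 1 , lw , zw with injective y w 1 ly lw
    ...   | refl = Adj⇒¬Dist-two (symm (Dist-one⇒Adj zw)) yz
    Dist-two-from-label-two⇒¬label-one {z} lz yz ly | w , 2 , lw , zw with injective z w 2 lz lw
    ...   | refl = Dist-suc⇒≢ zw refl
    Dist-two-from-label-two⇒¬label-one lz yz ly | w , suc (suc (suc k)) , lw , zw = Diam≤2⇒¬Dist≥3 diam≤2 zw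

    no-label-one : ∀ {y} → ¬ lab y ≡ just 1
    no-label-one {y} ly with dominated y
    ... | v , zero , lv , refl = labels-differ ly lv (λ ()) refl
    ... | v , 1 , lv , yv with injective y v 1 ly lv
    ...   | refl = Dist-suc⇒≢ yv refl
    no-label-one ly | z , 2 , lz , yz = Dist-two-from-label-two⇒¬label-one lz yz ly
    no-label-one ly | v , suc (suc (suc k)) , lv , yv = Diam≤2⇒¬Dist≥3 diam≤2 yv

    module _ {x} (lx : lab x ≡ just 0) where

      x-or-Dist-two-from-label-two : ∀ u → u ≡ x ⊎ ∃[ z ] (lab z ≡ just 2 × Dist Γ u z 2)
      x-or-Dist-two-from-label-two u with dominated u
      ... | v , zero , lv , refl = inj₁ (injective u x 0 lv lx)
      ... | v , 1 , lv , _ = ⊥-elim (no-label-one lv)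
      ... | z , 2 , lz , uz = inj₂ (z , lz , uz)
      ... | v , suc (suc (suc k)) , lv , uv = ⊥-elim (Diam≤2⇒¬Dist≥3 diam≤2 uv)

      Adj-label-two⇒≡x : ∀ {u z} → lab z ≡ just 2 → Adj u z → u ≡ x
      Adj-label-two⇒≡x {u} lz uz with x-or-Dist-two-from-label-two u
      ... | inj₁ u≡x = u≡x
      ... | inj₂ (z′ , lz′ , uz′) with injective _ z′ 2 lz lz′
      ...   | refl = ⊥-elim (Adj⇒¬Dist-two uz uz′)

      label-two-¬HasTwoNeighbours : ∀ {z} → lab z ≡ just 2 → ¬ HasTwoNeighbours z
      label-two-¬HasTwoNeighbours lz (u , v , uz , vz , u≢v) =
        u≢v (trans (Adj-label-two⇒≡x lz uz) (sym (Adj-label-two⇒≡x lz vz)))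

      distinct⇒label-two : ∀ {a b} → a ≢ b → ∃[ z ] lab z ≡ just 2
      distinct⇒label-two {a} {b} a≢b with x-or-Dist-two-from-label-two a | x-or-Dist-two-from-label-two b
      ... | inj₂ (z , lz , _) | _ = z , lz
      ... | inj₁ _ | inj₂ (z , lz , _) = z , lz
      ... | inj₁ a≡x | inj₁ b≡x = ⊥-elim (a≢b (trans a≡x (sym b≡x)))

      ¬Diam-one : ¬ Diam Γ 1
      ¬Diam-one diam@(_ , a , b , ab) with x-or-Dist-two-from-label-two a | x-or-Dist-two-from-label-two b
      ... | inj₁ a≡x | inj₁ b≡x = Dist-suc⇒≢ ab (trans a≡x (sym b≡x))
      ... | inj₂ (_ , _ , az) | _ with Dist≤Diam diam az
      ...   | s≤s ()
      ¬Diam-one diam | _ | inj₂ (_ , _ , bz) with Dist≤Diam diam bz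
      ...   | s≤s ()

proposition3p1 : ∀ {n : ℕ} (Γ : Graph n) → VertexTransitive Γ →
                 (Diam Γ 1 ⊎ Diam Γ 2) → ¬ AdmitsExtendedIrregularDominatingSet Γ
proposition3p1 Γ vt diam≤2 (lab , injective , dominated , _ , lx) with diam≤2
... | inj₁ diam₁ = ¬Diam-one Γ diam≤2 injective dominated lx diam₁
... | inj₂ (_ , a , b , ab@((ac ∷ (cb ∷ [])) , _))
  with distinct⇒label-two Γ diam≤2 injective dominated lx (Dist-suc⇒≢ Γ ab)
...   | z , lz = label-two-¬HasTwoNeighbours Γ diam≤2 injective dominated lx lz
  (VertexTransitive⇒HasTwoNeighbours Γ vt (a , b , ac , Graph.symm Γ cb , Dist-suc⇒≢ Γ ab) z)
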